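{- Let $\{X_m\}_{m\in\mathbb{Z}}$ be a sequence of complex numbers, let $x,y$ be non-vanishing complex numbers (not depending on $m$), and let $\alpha,\beta$ be integers such that \[ X_m = xX_{m-\alpha}+yX_{m-\beta}\quad\text{for all } m\in\mathbb{Z}. \] Then for every integer $m$ and every non-negative integer $k$: \[ y\sum_{j=0}^k \frac{X_{m-k\alpha-\beta+\alpha j}}{x^j} = \frac{X_m}{x^k} - xX_{m-(k+1)\alpha}, \] \[ x\sum_{j=0}^k \frac{X_{m-k\beta-\alpha+\beta j}}{y^j} = \frac{X_m}{y^k} - yX_{m-(k+1)\beta}, \] \[ \sum_{j=0}^k \frac{X_{m-(\beta-\alpha)k+\alpha+(\beta-\alpha)j}}{(-y/x)^j} = \frac{xX_m}{(-y/x)^k} + yX_{m-(k+1)(\beta-\alpha)}, \] \[ \sum_{j=0}^k \frac{X_{m-(\alpha-\beta)k+\beta+(\alpha-\beta)j}}{(-x/y)^j} = \frac{yX_m}{(-x/y)^k} + xX_{m-(k+1)(\alpha-\beta)}. \] -}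

module Defs where

open import Level using (Level; _⊔_) renaming (suc to lsuc)
open import Algebra.Bundles using (CommutativeRing)
open import Relation.Nullary using (¬_)
open import Data.Nat using (ℕ; zero; suc)

-- A field: a commutative ring with 0 ≠ 1 in which every non-zero element
-- has a multiplicative inverse (the value of _⁻¹ at 0# is irrelevant).
record Field (c ℓ : Level) : Set (lsuc (c ⊔ ℓ)) where
  field
    commutativeRing : CommutativeRing c ℓ
  open CommutativeRing commutativeRing public
  infix 8 _⁻¹
  field
    _⁻¹         : Carrier → Carrier
    ⁻¹-inverseʳ : ∀ a → ¬ (a ≈ 0#) → a * (a ⁻¹) ≈ 1#
    0≉1         : ¬ (0# ≈ 1#)

module FieldOps {c ℓ : Level} (F : Field c ℓ) where
  open Field F public hiding (zero)

  infixr 8 _^_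
  _^_ : Carrier → ℕ → Carrier
  a ^ zero  = 1#
  a ^ suc n = a * (a ^ n)

  infixl 7 _/_
  _/_ : Carrier → Carrier → Carrier
  a / b = a * (b ⁻¹)

  sumTo : ℕ → (ℕ → Carrier) → Carrier
  sumTo zero    f = f zero
  sumTo (suc k) f = sumTo k f + f (suc k)

module Submission where

-- Each identity comes from a three-term relation c·Y(n+e) = A·Y(n) + B·Y(n−s) with A·w + B = 0.
-- Dividing its instance at n − (k−j)s by w^j and summing over j, the middle terms cancel in pairs,
-- since A·Y/w^j + B·Y/w^(j+1) = (A·w + B)·Y/w^(j+1) = 0, and only the two ends survive.
-- The first two identities read the recurrence as y·X(n−β) = X(n) − x·X(n−α) (s = α, w = x),
-- the last two read it at n + α as X(n+α) = x·X(n) + y·X(n−(β−α)) (s = β−α, w = −y/x);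
-- in each pair the second is the first with (x, α) and (y, β) exchanged.

open import Defs
open import Data.Nat using (ℕ; zero; suc)
open import Data.Integer using (ℤ; +_) renaming (-_ to -ℤ_; _+_ to _+ℤ_; _-_ to _-ℤ_; _*_ to _*ℤ_)
open import Data.Integer.Properties using () renaming (*-identityˡ to *ℤ-identityˡ)
open import Data.Integer.Tactic.RingSolver using (solve-∀)
open import Data.Product using (_×_; _,_)
open import Relation.Nullary using (¬_)
open import Relation.Binary.PropositionalEquality using (_≡_; cong) renaming (sym to ≡-sym)
import Algebra.Solver.CommutativeMonoid as CommutativeMonoidSolver
import Algebra.Properties.Ring as RingProperties
import Relation.Binary.Reasoning.Setoid as SetoidReasoning

private
  shift-index : ∀ n e s K J → (n -ℤ s) +ℤ e -ℤ (K -ℤ J) *ℤ s ≡ n +ℤ e -ℤ (+ 1 +ℤ K -ℤ J) *ℤ s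
  shift-index = solve-∀

  last-index : ∀ n e s K → n +ℤ e -ℤ (K -ℤ K) *ℤ s ≡ n +ℤ e
  last-index = solve-∀

  shift-tail : ∀ n s K → (n -ℤ s) -ℤ K *ℤ s ≡ n -ℤ (+ 1 +ℤ K) *ℤ s
  shift-tail = solve-∀

  α-index : ∀ m α β K J → m -ℤ K *ℤ α -ℤ β +ℤ α *ℤ J ≡ m +ℤ -ℤ β -ℤ (K -ℤ J) *ℤ α
  α-index = solve-∀

  β-α-index : ∀ m α β K J → m -ℤ (β -ℤ α) *ℤ K +ℤ α +ℤ (β -ℤ α) *ℤ J ≡ m +ℤ α -ℤ (K -ℤ J) *ℤ (β -ℤ α)
  β-α-index = solve-∀

  i+j-j≡i : ∀ i j → i +ℤ j -ℤ j ≡ i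
  i+j-j≡i = solve-∀

  i+j-k≡i-[k-j] : ∀ i j k → i +ℤ j -ℤ k ≡ i -ℤ (k -ℤ j)
  i+j-k≡i-[k-j] = solve-∀

module FieldProperties {c ℓ} (F : Field c ℓ) where
  open FieldOps F
  open RingProperties ring using (-‿injective; -0#≈0#; -‿distribˡ-*; xyx⁻¹≈y)
  open CommutativeMonoidSolver *-commutativeMonoid using (solve; _⊜_; _⊕_)
  open CommutativeMonoidSolver +-commutativeMonoid using () renaming (solve to +-solve; _⊜_ to _⊜⁺_; _⊕_ to _⊕⁺_)
  open SetoidReasoning setoid

  ⁻¹-cancelˡ : ∀ {a} → ¬ (a ≈ 0#) → ∀ b → a ⁻¹ * (a * b) ≈ b
  ⁻¹-cancelˡ {a} a≉0 b = begin
    a ⁻¹ * (a * b)    ≈⟨ solve 3 (λ a a' b → a' ⊕ (a ⊕ b) ⊜ (a ⊕ a') ⊕ b) refl a (a ⁻¹) b ⟩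
    (a * a ⁻¹) * b    ≈⟨ *-congʳ (⁻¹-inverseʳ a a≉0) ⟩
    1# * b            ≈⟨ *-identityˡ b ⟩
    b                 ∎

  ⁻¹-unique : ∀ {a b} → ¬ (a ≈ 0#) → a * b ≈ 1# → b ≈ a ⁻¹
  ⁻¹-unique {a} {b} a≉0 ab≈1 = begin
    b               ≈⟨ ⁻¹-cancelˡ a≉0 b ⟨
    a ⁻¹ * (a * b)  ≈⟨ *-congˡ ab≈1 ⟩
    a ⁻¹ * 1#       ≈⟨ *-identityʳ (a ⁻¹) ⟩
    a ⁻¹            ∎

  1⁻¹≈1 : 1# ⁻¹ ≈ 1#
  1⁻¹≈1 = sym (⁻¹-unique (λ 1≈0 → 0≉1 (sym 1≈0)) (*-identityˡ 1#))

  *-≉0 : ∀ {a b} → ¬ (a ≈ 0#) → ¬ (b ≈ 0#) → ¬ (a * b ≈ 0#)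
  *-≉0 {a} {b} a≉0 b≉0 ab≈0 = b≉0 (begin
    b               ≈⟨ ⁻¹-cancelˡ a≉0 b ⟨
    a ⁻¹ * (a * b)  ≈⟨ *-congˡ ab≈0 ⟩
    a ⁻¹ * 0#       ≈⟨ zeroʳ (a ⁻¹) ⟩
    0#              ∎)

  -‿≉0 : ∀ {a} → ¬ (a ≈ 0#) → ¬ (- a ≈ 0#)
  -‿≉0 a≉0 -a≈0 = a≉0 (-‿injective (trans -a≈0 (sym -0#≈0#)))

  ⁻¹-≉0 : ∀ {a} → ¬ (a ≈ 0#) → ¬ (a ⁻¹ ≈ 0#)
  ⁻¹-≉0 {a} a≉0 a⁻¹≈0 = 0≉1 (begin
    0#          ≈⟨ zeroʳ a ⟨
    a * 0#      ≈⟨ *-congˡ a⁻¹≈0 ⟨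
    a * a ⁻¹    ≈⟨ ⁻¹-inverseʳ a a≉0 ⟩
    1#          ∎)

  /-≉0 : ∀ {a b} → ¬ (a ≈ 0#) → ¬ (b ≈ 0#) → ¬ (a / b ≈ 0#)
  /-≉0 a≉0 b≉0 = *-≉0 a≉0 (⁻¹-≉0 b≉0)

  ^-≉0 : ∀ {w} → ¬ (w ≈ 0#) → ∀ k → ¬ (w ^ k ≈ 0#)
  ^-≉0 w≉0 zero    1≈0 = 0≉1 (sym 1≈0)
  ^-≉0 w≉0 (suc k)     = *-≉0 w≉0 (^-≉0 w≉0 k)

  ^-⁻¹-suc : ∀ {w} → ¬ (w ≈ 0#) → ∀ k → (w ^ k) ⁻¹ ≈ w * (w ^ suc k) ⁻¹
  ^-⁻¹-suc {w} w≉0 k = sym (⁻¹-unique (^-≉0 w≉0 k) (begin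
    w ^ k * (w * (w ^ suc k) ⁻¹)  ≈⟨ solve 3 (λ p w v → p ⊕ (w ⊕ v) ⊜ (w ⊕ p) ⊕ v) refl (w ^ k) w ((w ^ suc k) ⁻¹) ⟩
    w ^ suc k * (w ^ suc k) ⁻¹    ≈⟨ ⁻¹-inverseʳ (w ^ suc k) (^-≉0 w≉0 (suc k)) ⟩
    1#                            ∎))

  sumTo-cong : ∀ k {f g : ℕ → Carrier} → (∀ j → f j ≈ g j) → sumTo k f ≈ sumTo k g
  sumTo-cong zero    f≈g = f≈g zero
  sumTo-cong (suc k) f≈g = +-cong (sumTo-cong k f≈g) (f≈g (suc k))

  module Telescope (Y : ℤ → Carrier) (e s : ℤ) {c A B w : Carrier} (w≉0 : ¬ (w ≈ 0#)) (Aw+B≈0 : A * w + B ≈ 0#)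
                   (recurrence : ∀ n → c * Y (n +ℤ e) ≈ A * Y n + B * Y (n -ℤ s)) where

    consecutive-cancel : ∀ k P → A * P / w ^ k + B * P / w ^ suc k ≈ 0#
    consecutive-cancel k P = begin
      A * P * (w ^ k) ⁻¹ + B * P * v        ≈⟨ +-congʳ (*-congˡ (^-⁻¹-suc w≉0 k)) ⟩
      A * P * (w * v) + B * P * v           ≈⟨ +-cong (solve 4 (λ A P w v → (A ⊕ P) ⊕ (w ⊕ v) ⊜ (A ⊕ w) ⊕ (P ⊕ v)) refl A P w v) (*-assoc B P v) ⟩
      A * w * (P * v) + B * (P * v)         ≈⟨ distribʳ (P * v) (A * w) B ⟨
      (A * w + B) * (P * v)                 ≈⟨ *-congʳ Aw+B≈0 ⟩
      0# * (P * v)                          ≈⟨ zeroˡ (P * v) ⟩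
      0#                                    ∎
      where v = (w ^ suc k) ⁻¹

    telescope : ∀ k n → c * sumTo k (λ j → Y (n +ℤ e -ℤ (+ k -ℤ + j) *ℤ s) / w ^ j)
                      ≈ A * Y n / w ^ k + B * Y (n -ℤ (+ suc k) *ℤ s)
    telescope zero n = begin
      c * (Y (n +ℤ e -ℤ (+ 0 -ℤ + 0) *ℤ s) * 1# ⁻¹)  ≈⟨ *-congˡ (*-cong (reflexive (cong Y (last-index n e s (+ 0)))) 1⁻¹≈1) ⟩
      c * (Y (n +ℤ e) * 1#)                         ≈⟨ *-congˡ (*-identityʳ _) ⟩
      c * Y (n +ℤ e)                                ≈⟨ recurrence n ⟩
      A * Y n + B * Y (n -ℤ s)                      ≈⟨ +-cong (sym (trans (*-congˡ 1⁻¹≈1) (*-identityʳ _)))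
                                                              (*-congˡ (reflexive (cong (λ t → Y (n -ℤ t)) (≡-sym (*ℤ-identityˡ s))))) ⟩
      A * Y n * 1# ⁻¹ + B * Y (n -ℤ + 1 *ℤ s)       ∎
    telescope (suc k) n = begin
      c * (S + Z * v)                               ≈⟨ trans (distribˡ c S (Z * v)) (+-congˡ (sym (*-assoc c Z v))) ⟩
      c * S + c * Z * v                             ≈⟨ +-cong earlier-terms (*-congʳ last-term) ⟩
      (A * P / w ^ k + B * T) + (A * Y n + B * P) * v
                                                    ≈⟨ +-congˡ (distribʳ v (A * Y n) (B * P)) ⟩
      (A * P / w ^ k + B * T) + (A * Y n * v + B * P * v)
                                                    ≈⟨ +-solve 4 (λ a b c d → (a ⊕⁺ b) ⊕⁺ (c ⊕⁺ d) ⊜⁺ (a ⊕⁺ d) ⊕⁺ (c ⊕⁺ b)) refl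
                                                                 (A * P / w ^ k) (B * T) (A * Y n * v) (B * P * v) ⟩
      (A * P / w ^ k + B * P * v) + (A * Y n * v + B * T)
                                                    ≈⟨ +-congʳ (consecutive-cancel k P) ⟩
      0# + (A * Y n * v + B * T)                    ≈⟨ +-identityˡ _ ⟩
      A * Y n * v + B * T                           ≈⟨ +-congˡ (*-congˡ (reflexive (cong Y (shift-tail n s (+ suc k))))) ⟩
      A * Y n * v + B * Y (n -ℤ (+ suc (suc k)) *ℤ s) ∎
      where
      S = sumTo k (λ j → Y (n +ℤ e -ℤ (+ suc k -ℤ + j) *ℤ s) / w ^ j)
      Z = Y (n +ℤ e -ℤ (+ suc k -ℤ + suc k) *ℤ s)
      v = (w ^ suc k) ⁻¹
      P = Y (n -ℤ s)
      T = Y ((n -ℤ s) -ℤ (+ suc k) *ℤ s)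
      earlier-terms : c * S ≈ A * P / w ^ k + B * T
      earlier-terms = trans (*-congˡ (sumTo-cong k (λ j → *-congʳ (reflexive (cong Y (≡-sym (shift-index n e s (+ k) (+ j))))))))
                            (telescope k (n -ℤ s))
      last-term : c * Z ≈ A * Y n + B * P
      last-term = trans (*-congˡ (reflexive (cong Y (last-index n e s (+ suc k))))) (recurrence n)

  α-progression-sum : (X : ℤ → Carrier) {x y : Carrier} (α β : ℤ) → ¬ (x ≈ 0#) →
    (∀ m → X m ≈ x * X (m -ℤ α) + y * X (m -ℤ β)) → ∀ (m : ℤ) (k : ℕ) →
    y * sumTo k (λ j → X (m -ℤ (+ k) *ℤ α -ℤ β +ℤ α *ℤ (+ j)) / (x ^ j))
      ≈ X m / (x ^ k) - x * X (m -ℤ (+ suc k) *ℤ α)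
  α-progression-sum X {x} {y} α β x≉0 rec m k = begin
    y * sumTo k (λ j → X (m -ℤ (+ k) *ℤ α -ℤ β +ℤ α *ℤ (+ j)) / x ^ j)
      ≈⟨ *-congˡ (sumTo-cong k (λ j → *-congʳ (reflexive (cong X (α-index m α β (+ k) (+ j)))))) ⟩
    y * sumTo k (λ j → X (m +ℤ -ℤ β -ℤ (+ k -ℤ + j) *ℤ α) / x ^ j)
      ≈⟨ telescope k m ⟩
    1# * X m / x ^ k + - x * X (m -ℤ (+ suc k) *ℤ α)
      ≈⟨ +-cong (*-congʳ (*-identityˡ (X m))) (sym (-‿distribˡ-* x _)) ⟩
    X m / x ^ k - x * X (m -ℤ (+ suc k) *ℤ α) ∎
    where
    recurrence : ∀ n → y * X (n -ℤ β) ≈ 1# * X n + - x * X (n -ℤ α)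
    recurrence n = begin
      y * X (n -ℤ β)                                    ≈⟨ xyx⁻¹≈y (x * X (n -ℤ α)) (y * X (n -ℤ β)) ⟨
      x * X (n -ℤ α) + y * X (n -ℤ β) - x * X (n -ℤ α)  ≈⟨ +-cong (sym (trans (*-identityˡ (X n)) (rec n))) (-‿distribˡ-* x _) ⟩
      1# * X n + - x * X (n -ℤ α)                       ∎
    open Telescope X (-ℤ β) α x≉0 (trans (+-congʳ (*-identityˡ x)) (-‿inverseʳ x)) recurrence

  β-α-progression-sum : (X : ℤ → Carrier) {x y : Carrier} (α β : ℤ) → ¬ (x ≈ 0#) → ¬ (y ≈ 0#) →
    (∀ m → X m ≈ x * X (m -ℤ α) + y * X (m -ℤ β)) → ∀ (m : ℤ) (k : ℕ) →
    sumTo k (λ j → X (m -ℤ (β -ℤ α) *ℤ (+ k) +ℤ α +ℤ (β -ℤ α) *ℤ (+ j)) / ((- y / x) ^ j))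
      ≈ x * X m / ((- y / x) ^ k) + y * X (m -ℤ (+ suc k) *ℤ (β -ℤ α))
  β-α-progression-sum X {x} {y} α β x≉0 y≉0 rec m k = begin
    sumTo k (λ j → X (m -ℤ (β -ℤ α) *ℤ (+ k) +ℤ α +ℤ (β -ℤ α) *ℤ (+ j)) / w ^ j)
      ≈⟨ *-identityˡ _ ⟨
    1# * sumTo k (λ j → X (m -ℤ (β -ℤ α) *ℤ (+ k) +ℤ α +ℤ (β -ℤ α) *ℤ (+ j)) / w ^ j)
      ≈⟨ *-congˡ (sumTo-cong k (λ j → *-congʳ (reflexive (cong X (β-α-index m α β (+ k) (+ j)))))) ⟩
    1# * sumTo k (λ j → X (m +ℤ α -ℤ (+ k -ℤ + j) *ℤ (β -ℤ α)) / w ^ j)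
      ≈⟨ telescope k m ⟩
    x * X m / w ^ k + y * X (m -ℤ (+ suc k) *ℤ (β -ℤ α)) ∎
    where
    w = - y / x
    xw+y≈0 : x * w + y ≈ 0#
    xw+y≈0 = begin
      x * (- y * x ⁻¹) + y  ≈⟨ +-congʳ (solve 3 (λ x y x' → x ⊕ (y ⊕ x') ⊜ (x ⊕ x') ⊕ y) refl x (- y) (x ⁻¹)) ⟩
      x * x ⁻¹ * - y + y    ≈⟨ +-congʳ (trans (*-congʳ (⁻¹-inverseʳ x x≉0)) (*-identityˡ (- y))) ⟩
      - y + y               ≈⟨ -‿inverseˡ y ⟩
      0#                    ∎
    recurrence : ∀ n → 1# * X (n +ℤ α) ≈ x * X n + y * X (n -ℤ (β -ℤ α))
    recurrence n = trans (*-identityˡ _) (trans (rec (n +ℤ α))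
      (+-cong (*-congˡ (reflexive (cong X (i+j-j≡i n α)))) (*-congˡ (reflexive (cong X (i+j-k≡i-[k-j] n α β))))))
    open Telescope X α (β -ℤ α) (/-≉0 (-‿≉0 y≉0) x≉0) xw+y≈0 recurrence

lemma4 : ∀ {c ℓ} (F : Field c ℓ) → let open FieldOps F in
         (X : ℤ → Carrier) (x y : Carrier) (α β : ℤ) →
         ¬ (x ≈ 0#) → ¬ (y ≈ 0#) →
         (∀ m → X m ≈ x * X (m -ℤ α) + y * X (m -ℤ β)) →
         ∀ (m : ℤ) (k : ℕ) →
           (y * sumTo k (λ j → X (m -ℤ (+ k) *ℤ α -ℤ β +ℤ α *ℤ (+ j)) / (x ^ j))
              ≈ X m / (x ^ k) - x * X (m -ℤ (+ suc k) *ℤ α))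
         × (x * sumTo k (λ j → X (m -ℤ (+ k) *ℤ β -ℤ α +ℤ β *ℤ (+ j)) / (y ^ j))
              ≈ X m / (y ^ k) - y * X (m -ℤ (+ suc k) *ℤ β))
         × (sumTo k (λ j → X (m -ℤ (β -ℤ α) *ℤ (+ k) +ℤ α +ℤ (β -ℤ α) *ℤ (+ j)) / ((- y / x) ^ j))
              ≈ x * X m / ((- y / x) ^ k) + y * X (m -ℤ (+ suc k) *ℤ (β -ℤ α)))
         × (sumTo k (λ j → X (m -ℤ (α -ℤ β) *ℤ (+ k) +ℤ β +ℤ (α -ℤ β) *ℤ (+ j)) / ((- x / y) ^ j))
              ≈ y * X m / ((- x / y) ^ k) + x * X (m -ℤ (+ suc k) *ℤ (α -ℤ β)))
lemma4 F X x y α β x≉0 y≉0 rec m k =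
    α-progression-sum X α β x≉0 rec m k
  , α-progression-sum X β α y≉0 rec-swapped m k
  , β-α-progression-sum X α β x≉0 y≉0 rec m k
  , β-α-progression-sum X β α y≉0 x≉0 rec-swapped m k
  where
  open FieldProperties F
  open FieldOps F using (_≈_; _*_; _+_; trans; +-comm)
  rec-swapped : ∀ n → X n ≈ y * X (n -ℤ β) + x * X (n -ℤ α)
  rec-swapped n = trans (rec n) (+-comm _ _)
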